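{- Let $\mathcal{G}=\langle \mathit{Init},\mathit{Safe},\mathit{Reach},\mathit{Goal}\rangle$, $\mathcal{G}_T=\langle \mathit{Init}_T,\mathit{Safe}_T,\mathit{Reach}_T,\mathit{Goal}_T\rangle$ and $\mathcal{G}_F=\langle \mathit{Init}_F,\mathit{Safe}_F,\mathit{Reach}_F,\mathit{Goal}_F\rangle$ be reachability games, and let $T,F$ be transition predicates such that $\operatorname{Pre}(T)\land\operatorname{Pre}(F)$ is unsatisfiable. Suppose that $\operatorname{Enf}(T,\mathcal{G}_T)$ and $\operatorname{Enf}(F,\mathcal{G}_F)$ are both unsatisfiable, and that the implications $$T\Rightarrow(\mathit{Safe}_T\lor\mathit{Reach}_T)\Rightarrow(\mathit{Safe}\lor\mathit{Reach}),\qquad F\Rightarrow(\mathit{Safe}_F\lor\mathit{Reach}_F)\Rightarrow(\mathit{Safe}\lor\mathit{Reach})$$ are valid. Then $\operatorname{Enf}(T\lor F,\mathcal{G})$ is unsatisfiable.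
   Context: Fix a logic $\mathcal{L}$ and a finite set of variables $\mathcal{V}$ with domains, primed copies $\mathcal{V}'$, and a Boolean variable $\mathbf{r}\in\mathcal{V}$. A reachability game $\langle \mathit{Init},\mathit{Safe},\mathit{Reach},\mathit{Goal}\rangle$ consists of state predicates $\mathit{Init},\mathit{Goal}\in\mathcal{L}(\mathcal{V})$ and transition predicates $\mathit{Safe},\mathit{Reach}\in\mathcal{L}(\mathcal{V}\cup\mathcal{V}')$ such that $\mathit{Safe}\Rightarrow\neg\mathbf{r}$ and $\mathit{Reach}\Rightarrow\mathbf{r}$ are valid. $\operatorname{Pre}(T)=\exists\mathcal{V}'.T$, and for a game $\mathcal{G}$, $\operatorname{Enf}(T,\mathcal{G})=(\mathit{Safe}\lor\mathit{Reach})\land T\land\neg\exists\mathcal{V}'.(\mathit{Safe}\land\neg T)$, where $\mathit{Safe},\mathit{Reach}$ are those of $\mathcal{G}$. -}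

module Defs where

open import Data.Bool using (Bool; true; false)
open import Data.Product using (Σ; _×_; ∃)
open import Data.Sum using (_⊎_)
open import Relation.Nullary using (¬_)
open import Relation.Binary.PropositionalEquality using (_≡_)

-- Semantic reading of the logic: a valuation of the variables V is a
-- state of type State; a state predicate (formula over V) is a
-- predicate on State; a transition predicate (formula over V ∪ V') is a
-- relation on State (first argument = unprimed valuation, second =
-- primed valuation). The Boolean variable r is read off by rv.

StatePred : Set → Set₁
StatePred S = S → Set

TransPred : Set → Set₁
TransPred S = S → S → Set

_⇛_ : {S : Set} → TransPred S → TransPred S → Set
_⇛_ {S} A B = ∀ (s s' : S) → A s s' → B s s'

_∨ᵗ_ : {S : Set} → TransPred S → TransPred S → TransPred S
(A ∨ᵗ B) s s' = A s s' ⊎ B s s'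

UnsatS : {S : Set} → StatePred S → Set
UnsatS {S} P = ∀ (s : S) → ¬ P s

UnsatT : {S : Set} → TransPred S → Set
UnsatT {S} A = ∀ (s s' : S) → ¬ A s s'

Pre : {S : Set} → TransPred S → StatePred S
Pre {S} T s = Σ S (λ s' → T s s')

record Game (S : Set) (rv : S → Bool) : Set₁ where
  field
    Init  : StatePred S
    Safe  : TransPred S
    Reach : TransPred S
    Goal  : StatePred S
    safe⇒¬r : ∀ (s s' : S) → Safe s s' → rv s ≡ false
    reach⇒r : ∀ (s s' : S) → Reach s s' → rv s ≡ true

Enf : {S : Set} {rv : S → Bool} → TransPred S → Game S rv → TransPred S
Enf {S} T G s s' =
  (Game.Safe G s s' ⊎ Game.Reach G s s') × T s s'
    × ¬ (Σ S (λ s'' → Game.Safe G s s'' × ¬ T s s''))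

module Submission where

open import Defs
open import Data.Bool using (Bool)
open import Data.Product as Product using (_×_; _,_)
open import Data.Sum as Sum using (inj₁; inj₂)
open import Function using (_∘_)
open import Relation.Nullary using (¬_)
open import Relation.Binary.PropositionalEquality using (trans; sym)

module _ {S : Set} {rv : S → Bool} where

  -- A Safe-move of G has r = false at its source and a Reach-move of H has r = true.
  safe-mono : (G H : Game S rv)
    → (Game.Safe G ∨ᵗ Game.Reach G) ⇛ (Game.Safe H ∨ᵗ Game.Reach H)
    → Game.Safe G ⇛ Game.Safe H
  safe-mono G H G⇛H s s' safe with G⇛H s s' (inj₁ safe)
  ... | inj₁ safeH = safeH
  ... | inj₂ reachH
    with () ← trans (sym (Game.safe⇒¬r G s s' safe)) (Game.reach⇒r H s s' reachH)

  Enf-∨-comm : (G : Game S rv) (T F : TransPred S)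
    → Enf (T ∨ᵗ F) G ⇛ Enf (F ∨ᵗ T) G
  Enf-∨-comm G T F s s' (move , t∨f , no-escape) =
    move , Sum.swap t∨f , λ (s'' , safe , ¬f∨t) → no-escape (s'' , safe , ¬f∨t ∘ Sum.swap)

  -- An F-move from the source of a T-move is excluded, so a safe escape from
  -- T ∨ F in G is a safe escape from T alone, and lies in the finer game H.
  Enf-∨-unsat-on : (G H : Game S rv) (T F : TransPred S)
    → UnsatS (λ s → Pre T s × Pre F s)
    → UnsatT (Enf T H)
    → T ⇛ (Game.Safe H ∨ᵗ Game.Reach H)
    → (Game.Safe H ∨ᵗ Game.Reach H) ⇛ (Game.Safe G ∨ᵗ Game.Reach G)
    → ∀ s s' → T s s' → ¬ Enf (T ∨ᵗ F) G s s'
  Enf-∨-unsat-on G H T F disjoint enfH-unsat T⇛H H⇛G s s' t (_ , _ , no-escape) =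
    enfH-unsat s s' (T⇛H s s' t , t , λ (s'' , safe , ¬t) →
      no-escape (s'' , safe-mono H G H⇛G s s'' safe , λ
        { (inj₁ t'') → ¬t t''
        ; (inj₂ f'') → disjoint s ((s' , t) , (s'' , f'')) }))

lemma8 : (S : Set) (rv : S → Bool) (G GT GF : Game S rv) (T F : TransPred S)
    → UnsatS (λ s → Pre T s × Pre F s)
    → UnsatT (Enf T GT)
    → UnsatT (Enf F GF)
    → T ⇛ (Game.Safe GT ∨ᵗ Game.Reach GT)
    → (Game.Safe GT ∨ᵗ Game.Reach GT) ⇛ (Game.Safe G ∨ᵗ Game.Reach G)
    → F ⇛ (Game.Safe GF ∨ᵗ Game.Reach GF)
    → (Game.Safe GF ∨ᵗ Game.Reach GF) ⇛ (Game.Safe G ∨ᵗ Game.Reach G)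
    → UnsatT (Enf (T ∨ᵗ F) G)
lemma8 S rv G GT GF T F disjoint enfT-unsat enfF-unsat T⇛GT GT⇛G F⇛GF GF⇛G
  s s' enf@(_ , inj₁ t , _) =
  Enf-∨-unsat-on G GT T F disjoint enfT-unsat T⇛GT GT⇛G s s' t enf
lemma8 S rv G GT GF T F disjoint enfT-unsat enfF-unsat T⇛GT GT⇛G F⇛GF GF⇛G
  s s' enf@(_ , inj₂ f , _) =
  Enf-∨-unsat-on G GF F T (λ s → disjoint s ∘ Product.swap) enfF-unsat F⇛GF GF⇛G
    s s' f (Enf-∨-comm G T F s s' enf)
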